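{- A set $\chi$ of equational constraints of the form $t=\mathcal T(t')$ ($t,t'$ string terms, $\mathcal T$ a rational function) is chain-free if and only if the set $\psi$ of its normal forms is chain-free.
   Context: $\Sigma$ is a finite alphabet. A string term is a concatenation of variables and constant strings (variables may repeat). A rational function is a function realized by a one-way finite-state transducer; the identity is allowed, so a word equation $t=t'$ is of this form. For equational constraints $\phi_j=(t_{2j-1}=\mathcal T_j(t_{2j}))$, $j=1,\dots,n$, the splitting graph has nodes $(l,i)$, $1\le l\le 2n$, $1\le i\le n_l$ ($n_l$ the number of variable occurrences in $t_l$), node $(l,i)$ labelled by the variable at the $i$-th variable occurrence of $t_l$; nodes of $t_{2j-1}$ and of $t_{2j}$ lie on opposite sides of $\phi_j$. There is an edge from $p$ to $q$ iff there is a node $p'\neq q$ such that $p$ and $p'$ lie on opposite sides of the same constraint and $p'$ and $q$ have the same label. A chain is a cycle $(p_0,p_1),\dots,(p_k,p_0)$ of edges; a set of equational constraints is chain-free if its splitting graph has no chain. The normal form of $t_{2j-1}=\mathcal T_j(t_{2j})$ consists of the three constraints $x=t_{2j-1}$, $y=t_{2j}$ (both with identity transducer) and $x=\mathcal T_j(y)$, where $x,y$ are fresh variables; the normal form of a set is obtained by doing this for every constraint. -}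

module Defs where

open import Data.Nat using (ℕ)
open import Data.Fin using (Fin; zero)
open import Data.Bool using (Bool; true; false; not)
open import Data.Maybe using (Maybe; just; nothing)
open import Data.List using (List; []; _∷_; _++_; length; lookup; map; concat; concatMap; tabulate; allFin)
open import Data.List.Membership.Propositional using (_∈_; _∉_)
open import Data.List.Relation.Unary.All using (All)
open import Data.List.Relation.Unary.Unique.Propositional using (Unique)
open import Data.Product using (Σ; Σ-syntax; ∃; _×_; _,_; proj₁; proj₂)
open import Relation.Binary.PropositionalEquality using (_≡_; _≢_)
open import Relation.Binary.Construct.Closure.Transitive using (TransClosure)
open import Relation.Nullary using (¬_)

Word : ℕ → Set
Word k = List (Fin k)

-- Variables are natural numbers (an infinite supply, so fresh variables exist)
Var : Set
Var = ℕ

data Sym (k : ℕ) : Set where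
  var : Var → Sym k
  str : Word k → Sym k

Term : ℕ → Set
Term k = List (Sym k)

vars : {k : ℕ} → Term k → List Var
vars []             = []
vars (var x ∷ t)    = x ∷ vars t
vars (str w ∷ t)    = vars t

-- One-way finite-state transducers (real-time, with final outputs)

record Transducer (k : ℕ) : Set where
  field
    Q     : ℕ
    init  : Fin Q
    trans : List (Fin Q × Fin k × Word k × Fin Q)   -- (q , a , output , q')
    final : Fin Q → Maybe (Word k)                  -- final output, if final

open Transducer public

data Run {k : ℕ} (T : Transducer k) : Fin (Q T) → Word k → Word k → Set where
  stop : ∀ {q w} → final T q ≡ just w → Run T q [] w
  step : ∀ {q q' a w u v} → (q , a , w , q') ∈ trans T →
         Run T q' u v → Run T q (a ∷ u) (w ++ v)

Realizes : {k : ℕ} → Transducer k → Word k → Word k → Set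
Realizes T u v = Run T (init T) u v

IsRational : {k : ℕ} → Transducer k → Set
IsRational T = ∀ {u v v'} → Realizes T u v → Realizes T u v' → v ≡ v'

idT : (k : ℕ) → Transducer k
idT k = record
  { Q     = 1
  ; init  = zero
  ; trans = map (λ a → (zero , a , a ∷ [] , zero)) (allFin k)
  ; final = λ _ → just []
  }

record Constraint (k : ℕ) : Set where
  constructor _≐_⟨_⟩
  field
    lhs : Term k
    tr  : Transducer k
    rhs : Term k

open Constraint public

side : {k : ℕ} → Bool → Constraint k → Term k
side true  c = lhs c
side false c = rhs c

AllRational : {k : ℕ} → List (Constraint k) → Set
AllRational cs = All (λ c → IsRational (tr c)) cs

-- A node (l , i): constraint index j, side s (so l = 2j-1 or 2j), and
-- the index i of a variable occurrence of the term t_l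
Node : {k : ℕ} → List (Constraint k) → Set
Node cs = Σ[ j ∈ Fin (length cs) ] Σ[ s ∈ Bool ]
            Fin (length (vars (side s (lookup cs j))))

cIx : {k : ℕ} {cs : List (Constraint k)} → Node cs → Fin (length cs)
cIx (j , _ , _) = j

sideOf : {k : ℕ} {cs : List (Constraint k)} → Node cs → Bool
sideOf (_ , s , _) = s

label : {k : ℕ} {cs : List (Constraint k)} → Node cs → Var
label {cs = cs} (j , s , i) = lookup (vars (side s (lookup cs j))) i

Opposite : {k : ℕ} (cs : List (Constraint k)) → Node cs → Node cs → Set
Opposite cs p p' = (cIx {cs = cs} p ≡ cIx {cs = cs} p') × (sideOf {cs = cs} p' ≡ not (sideOf {cs = cs} p))

Edge : {k : ℕ} (cs : List (Constraint k)) → Node cs → Node cs → Set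
Edge cs p q = Σ[ p' ∈ Node cs ] (p' ≢ q) × Opposite cs p p' × (label {cs = cs} p' ≡ label {cs = cs} q)

Chain : {k : ℕ} (cs : List (Constraint k)) → Set
Chain cs = Σ[ p ∈ Node cs ] TransClosure (Edge cs) p p

ChainFree : {k : ℕ} → List (Constraint k) → Set
ChainFree cs = ¬ Chain cs

nfOne : {k : ℕ} → Constraint k → Var × Var → List (Constraint k)
nfOne {k} c (x , y) =
    ((var x ∷ []) ≐ idT k ⟨ lhs c ⟩)
  ∷ ((var y ∷ []) ≐ idT k ⟨ rhs c ⟩)
  ∷ ((var x ∷ []) ≐ tr c ⟨ (var y ∷ []) ⟩)
  ∷ []

-- f j = (x_j , y_j): the fresh variables chosen for the j-th constraint
normalForm : {k : ℕ} (cs : List (Constraint k)) →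
             (Fin (length cs) → Var × Var) → List (Constraint k)
normalForm cs f = concat (tabulate (λ j → nfOne (lookup cs j) (f j)))

allVars : {k : ℕ} → List (Constraint k) → List Var
allVars cs = concatMap (λ c → vars (lhs c) ++ vars (rhs c)) cs

freshVars : {k : ℕ} (cs : List (Constraint k)) →
            (Fin (length cs) → Var × Var) → List Var
freshVars cs f = concat (tabulate (λ j → proj₁ (f j) ∷ proj₂ (f j) ∷ []))

Fresh : {k : ℕ} (cs : List (Constraint k)) → (Fin (length cs) → Var × Var) → Set
Fresh cs f = Unique (freshVars cs f) × All (λ x → x ∉ allVars cs) (freshVars cs f)

{-# OPTIONS --safe #-}
module Submission where

-- Each fresh variable labels exactly two vertices of the splitting graph of the normal form, so
-- paths through them are forced.  An occurrence n on side s of constraint j reappears as a copy in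
-- the definition of that side's fresh variable (x = t or y = t').  From the copy the only edge
-- leads to the same fresh variable in x = T(y), from there the only edge leads to the other fresh
-- variable at the head of its definition, and from there the edges lead to the copies of exactly
-- the successors of n in the splitting graph of χ.  Hence edges of χ become paths of length three
-- between copies, and every chain of the normal form passes through a copy and contracts back to
-- a chain of χ.

open import Defs hiding (trans)
open import Data.Nat using (ℕ; suc)
open import Data.Fin using (Fin; zero; suc)
open import Data.Bool using (Bool; true; false; not)
open import Data.Sum using (_⊎_; inj₁; inj₂)
open import Data.List using (List; []; _∷_; _++_; length; lookup; concat; tabulate)
open import Data.List.Membership.Propositional using (_∈_)
open import Data.List.Membership.Propositional.Properties using (∈-++⁺ˡ; ∈-++⁺ʳ; ∈-lookup)
open import Data.List.Relation.Unary.All as All using (_∷_)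
open import Data.List.Relation.Unary.Any using (here; there)
open import Data.List.Relation.Unary.AllPairs using (_∷_)
open import Data.List.Relation.Unary.Unique.Propositional using (Unique)
open import Data.Product using (Σ-syntax; _×_; _,_; proj₁; proj₂; uncurry; map₁)
open import Data.Empty using (⊥-elim)
open import Relation.Binary.PropositionalEquality
open import Relation.Binary.Construct.Closure.Transitive using (TransClosure; [_]; _∷_; _∷ʳ_)
  renaming (_++_ to _⁺++_)

module _ {A B : Set} {R : A → A → Set} {S : B → B → Set} (f : A → B) where

  bind⁺ : (∀ {x y} → R x y → TransClosure S (f x) (f y)) →
          ∀ {x y} → TransClosure R x y → TransClosure S (f x) (f y)
  bind⁺ h [ e ]    = h e
  bind⁺ h (e ∷ es) = h e ⁺++ bind⁺ h es

rotate : ∀ {A : Set} {R : A → A → Set} {x} →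
         TransClosure R x x → Σ[ y ∈ A ] R x y × TransClosure R y y
rotate [ e ]    = _ , e , [ e ]
rotate (e ∷ es) = _ , e , es ∷ʳ e

-- For I = Fin (length cs) and c = lookup cs, Vertex, vertexLabel, Step and Cycle are definitionally
-- Node, label, Edge and Chain of cs.
module Splitting {k : ℕ} {I : Set} (c : I → Constraint k) where

  Vertex : Set
  Vertex = Σ[ a ∈ I ] Σ[ s ∈ Bool ] Fin (length (vars (side s (c a))))

  vertexIndex : Vertex → I
  vertexIndex (a , _ , _) = a

  vertexSide : Vertex → Bool
  vertexSide (_ , s , _) = s

  vertexLabel : Vertex → Var
  vertexLabel (a , s , i) = lookup (vars (side s (c a))) i

  Step : Vertex → Vertex → Set
  Step p q = Σ[ p' ∈ Vertex ] (p' ≢ q)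
           × ((vertexIndex p ≡ vertexIndex p') × (vertexSide p' ≡ not (vertexSide p)))
           × (vertexLabel p' ≡ vertexLabel q)

  Cycle : Set
  Cycle = Σ[ p ∈ Vertex ] TransClosure Step p p

open Splitting

record Embedding {k : ℕ} {I J : Set} (c : I → Constraint k) (d : J → Constraint k) : Set where
  field
    vertex       : Vertex c → Vertex d
    retraction   : Vertex d → Vertex c
    retract      : ∀ u → retraction (vertex u) ≡ u
    reindex      : I → J
    index-vertex : ∀ u → vertexIndex d (vertex u) ≡ reindex (vertexIndex c u)
    side-vertex  : ∀ u → vertexSide d (vertex u) ≡ vertexSide c u
    label-vertex : ∀ u → vertexLabel d (vertex u) ≡ vertexLabel c u

  injective : ∀ {u v} → vertex u ≡ vertex v → u ≡ v
  injective {u} {v} eq = trans (sym (retract u)) (trans (cong retraction eq) (retract v))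

  map-step : ∀ {u v} → Step c u v → Step d (vertex u) (vertex v)
  map-step {u} {v} (u' , u'≢v , (same , flip) , lab) =
      vertex u'
    , (λ eq → u'≢v (injective eq))
    , ( trans (index-vertex u) (trans (cong reindex same) (sym (index-vertex u')))
      , trans (side-vertex u') (trans flip (cong not (sym (side-vertex u)))) )
    , trans (label-vertex u') (trans lab (sym (label-vertex v)))

  map-cycle : Cycle c → Cycle d
  map-cycle (u , u⁺u) = vertex u , bind⁺ vertex (λ e → [ map-step e ]) u⁺u

-- The normal form of one constraint t = T(t'): define true is x = t, define false is y = t',
-- transfer is x = T(y).
data Block : Set where
  define   : Bool → Block
  transfer : Block

blocks : ∀ {k m} → (Fin m → Block → Constraint k) → List (Constraint k)
blocks g = concat (tabulate (λ j → g j (define true) ∷ g j (define false) ∷ g j transfer ∷ []))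

module _ {k : ℕ} where

  BlockFamily : ℕ → Set
  BlockFamily m = Fin m → Block → Constraint k

  -- Recursing through these helpers rather than 'with' makes decode (encode u) reduce by eta.
  private
    sucVertex : ∀ {m} (g : BlockFamily (suc m)) →
                Vertex (uncurry (λ j → g (suc j))) → Vertex (uncurry g)
    sucVertex g ((j , r) , s , i) = (suc j , r) , s , i

    suc³Vertex : ∀ {m} (g : BlockFamily (suc m)) →
                 Vertex (lookup (blocks (λ j → g (suc j)))) → Vertex (lookup (blocks g))
    suc³Vertex g (J , s , i) = suc (suc (suc J)) , s , i

  encodeIndex : ∀ {m} (g : BlockFamily m) → Fin m × Block → Fin (length (blocks g))
  encodeIndex g (zero , define true)  = zero
  encodeIndex g (zero , define false) = suc zero
  encodeIndex g (zero , transfer)     = suc (suc zero)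
  encodeIndex g (suc j , r)           = suc (suc (suc (encodeIndex (λ j → g (suc j)) (j , r))))

  decodeIndex : ∀ {m} (g : BlockFamily m) → Fin (length (blocks g)) → Fin m × Block
  decodeIndex {suc m} g zero                = zero , define true
  decodeIndex {suc m} g (suc zero)          = zero , define false
  decodeIndex {suc m} g (suc (suc zero))    = zero , transfer
  decodeIndex {suc m} g (suc (suc (suc J))) = map₁ suc (decodeIndex (λ j → g (suc j)) J)

  encode : ∀ {m} (g : BlockFamily m) →
           Vertex (uncurry g) → Vertex (lookup (blocks g))
  encode g ((zero , define true)  , s , i) = zero , s , i
  encode g ((zero , define false) , s , i) = suc zero , s , i
  encode g ((zero , transfer)     , s , i) = suc (suc zero) , s , i
  encode g ((suc j , r)           , s , i) = suc³Vertex g (encode (λ j → g (suc j)) ((j , r) , s , i))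

  decode : ∀ {m} (g : BlockFamily m) →
           Vertex (lookup (blocks g)) → Vertex (uncurry g)
  decode {suc m} g (zero , s , i)              = (zero , define true) , s , i
  decode {suc m} g (suc zero , s , i)          = (zero , define false) , s , i
  decode {suc m} g (suc (suc zero) , s , i)    = (zero , transfer) , s , i
  decode {suc m} g (suc (suc (suc J)) , s , i) = sucVertex g (decode (λ j → g (suc j)) (J , s , i))

  decode-encode : ∀ {m} (g : BlockFamily m) u → decode g (encode g u) ≡ u
  decode-encode g ((zero , define true)  , s , i) = refl
  decode-encode g ((zero , define false) , s , i) = refl
  decode-encode g ((zero , transfer)     , s , i) = refl
  decode-encode g ((suc j , r)           , s , i) =
    cong (sucVertex g) (decode-encode (λ j → g (suc j)) ((j , r) , s , i))

  encode-decode : ∀ {m} (g : BlockFamily m) p → encode g (decode g p) ≡ p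
  encode-decode {suc m} g (zero , s , i)              = refl
  encode-decode {suc m} g (suc zero , s , i)          = refl
  encode-decode {suc m} g (suc (suc zero) , s , i)    = refl
  encode-decode {suc m} g (suc (suc (suc J)) , s , i) =
    cong (suc³Vertex g) (encode-decode (λ j → g (suc j)) (J , s , i))

  index-encode : ∀ {m} (g : BlockFamily m) u →
                 vertexIndex (lookup (blocks g)) (encode g u) ≡ encodeIndex g (vertexIndex (uncurry g) u)
  index-encode g ((zero , define true)  , s , i) = refl
  index-encode g ((zero , define false) , s , i) = refl
  index-encode g ((zero , transfer)     , s , i) = refl
  index-encode g ((suc j , r)           , s , i) =
    cong (λ J → suc (suc (suc J))) (index-encode (λ j → g (suc j)) ((j , r) , s , i))

  side-encode : ∀ {m} (g : BlockFamily m) u →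
                vertexSide (lookup (blocks g)) (encode g u) ≡ vertexSide (uncurry g) u
  side-encode g ((zero , define true)  , s , i) = refl
  side-encode g ((zero , define false) , s , i) = refl
  side-encode g ((zero , transfer)     , s , i) = refl
  side-encode g ((suc j , r)           , s , i) = side-encode (λ j → g (suc j)) ((j , r) , s , i)

  label-encode : ∀ {m} (g : BlockFamily m) u →
                 vertexLabel (lookup (blocks g)) (encode g u) ≡ vertexLabel (uncurry g) u
  label-encode g ((zero , define true)  , s , i) = refl
  label-encode g ((zero , define false) , s , i) = refl
  label-encode g ((zero , transfer)     , s , i) = refl
  label-encode g ((suc j , r)           , s , i) = label-encode (λ j → g (suc j)) ((j , r) , s , i)

  index-decode : ∀ {m} (g : BlockFamily m) p →
                 vertexIndex (uncurry g) (decode g p) ≡ decodeIndex g (vertexIndex (lookup (blocks g)) p)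
  index-decode {suc m} g (zero , s , i)              = refl
  index-decode {suc m} g (suc zero , s , i)          = refl
  index-decode {suc m} g (suc (suc zero) , s , i)    = refl
  index-decode {suc m} g (suc (suc (suc J)) , s , i) =
    cong (map₁ suc) (index-decode (λ j → g (suc j)) (J , s , i))

  side-decode : ∀ {m} (g : BlockFamily m) p →
                vertexSide (uncurry g) (decode g p) ≡ vertexSide (lookup (blocks g)) p
  side-decode {suc m} g (zero , s , i)              = refl
  side-decode {suc m} g (suc zero , s , i)          = refl
  side-decode {suc m} g (suc (suc zero) , s , i)    = refl
  side-decode {suc m} g (suc (suc (suc J)) , s , i) = side-decode (λ j → g (suc j)) (J , s , i)

  label-decode : ∀ {m} (g : BlockFamily m) p →
                 vertexLabel (uncurry g) (decode g p) ≡ vertexLabel (lookup (blocks g)) p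
  label-decode {suc m} g (zero , s , i)              = refl
  label-decode {suc m} g (suc zero , s , i)          = refl
  label-decode {suc m} g (suc (suc zero) , s , i)    = refl
  label-decode {suc m} g (suc (suc (suc J)) , s , i) = label-decode (λ j → g (suc j)) (J , s , i)

  encoding : ∀ {m} (g : BlockFamily m) → Embedding (uncurry g) (lookup (blocks g))
  encoding g = record
    { vertex       = encode g
    ; retraction   = decode g
    ; retract      = decode-encode g
    ; reindex      = encodeIndex g
    ; index-vertex = index-encode g
    ; side-vertex  = side-encode g
    ; label-vertex = label-encode g
    }

  decoding : ∀ {m} (g : BlockFamily m) → Embedding (lookup (blocks g)) (uncurry g)
  decoding g = record
    { vertex       = decode g
    ; retraction   = encode g
    ; retract      = encode-decode g
    ; reindex      = decodeIndex g
    ; index-vertex = index-decode g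
    ; side-vertex  = side-decode g
    ; label-vertex = label-decode g
    }

module _ {A : Set} where

  interleave : ∀ {m} → (Fin m → Bool → A) → List A
  interleave h = concat (tabulate (λ j → h j true ∷ h j false ∷ []))

  ∈-interleave : ∀ {m} (h : Fin m → Bool → A) j s → h j s ∈ interleave h
  ∈-interleave h zero    true  = here refl
  ∈-interleave h zero    false = there (here refl)
  ∈-interleave h (suc j) s     = there (there (∈-interleave (λ j → h (suc j)) j s))

  private
    head∉tail : ∀ {m} (h : Fin (suc m) → Bool → A) → Unique (interleave h) →
                ∀ s j s' → h zero s ≢ h (suc j) s'
    head∉tail h ((_ ∷ x∉) ∷ _) true  j s' = All.lookup x∉ (∈-interleave (λ j → h (suc j)) j s')
    head∉tail h (_ ∷ y∉ ∷ _)   false j s' = All.lookup y∉ (∈-interleave (λ j → h (suc j)) j s')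

  interleave-injective : ∀ {m} (h : Fin m → Bool → A) → Unique (interleave h) →
                         ∀ {j s j' s'} → h j s ≡ h j' s' → (j , s) ≡ (j' , s')
  interleave-injective h _               {zero}  {true}  {zero}   {true}  _  = refl
  interleave-injective h _               {zero}  {false} {zero}   {false} _  = refl
  interleave-injective h ((x≢y ∷ _) ∷ _) {zero}  {true}  {zero}   {false} eq = ⊥-elim (x≢y eq)
  interleave-injective h ((x≢y ∷ _) ∷ _) {zero}  {false} {zero}   {true}  eq = ⊥-elim (x≢y (sym eq))
  interleave-injective h u               {zero}  {s}     {suc j'} {s'}    eq =
    ⊥-elim (head∉tail h u s j' s' eq)
  interleave-injective h u               {suc j} {s}     {zero}   {s'}    eq =
    ⊥-elim (head∉tail h u s' j s (sym eq))
  interleave-injective h (_ ∷ _ ∷ u)     {suc j} {s}     {suc j'} {s'}    eq =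
    cong (map₁ suc) (interleave-injective (λ j → h (suc j)) u eq)

label∈allVars : ∀ {k} (χ : List (Constraint k)) p → label {cs = χ} p ∈ allVars χ
label∈allVars (c ∷ χ) (zero , true , i)  = ∈-++⁺ˡ (∈-++⁺ˡ (∈-lookup {xs = vars (lhs c)} i))
label∈allVars (c ∷ χ) (zero , false , i) =
  ∈-++⁺ˡ (∈-++⁺ʳ (vars (lhs c)) (∈-lookup {xs = vars (rhs c)} i))
label∈allVars (c ∷ χ) (suc j , s , i)    =
  ∈-++⁺ʳ (vars (lhs c) ++ vars (rhs c)) (label∈allVars χ (j , s , i))

module NormalForm {k : ℕ} (χ : List (Constraint k)) (f : Fin (length χ) → Var × Var)
                  (isFresh : Fresh χ f) where

  fresh : Fin (length χ) → Bool → Var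
  fresh j true  = proj₁ (f j)
  fresh j false = proj₂ (f j)

  -- blocks nfBlock reduces to normalForm χ f, which lemma10 uses silently.
  nfBlock : Fin (length χ) → Block → Constraint k
  nfBlock j (define s) = (var (fresh j s) ∷ []) ≐ idT k ⟨ side s (lookup χ j) ⟩
  nfBlock j transfer   = (var (fresh j true) ∷ []) ≐ tr (lookup χ j) ⟨ var (fresh j false) ∷ [] ⟩

  private
    NFVertex : Set
    NFVertex = Vertex (uncurry nfBlock)

    nfLabel : NFVertex → Var
    nfLabel = vertexLabel (uncurry nfBlock)

    _↦_ : NFVertex → NFVertex → Set
    _↦_ = Step (uncurry nfBlock)

    _⇝_ : NFVertex → NFVertex → Set
    _⇝_ = TransClosure _↦_

    _⇝χ_ : Node χ → Node χ → Set
    _⇝χ_ = TransClosure (Edge χ)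

  copy : Node χ → NFVertex
  copy (j , s , i) = (j , define s) , false , i

  definedVar : Fin (length χ) → Bool → NFVertex
  definedVar j s = (j , define s) , true , zero

  transferVar : Fin (length χ) → Bool → NFVertex
  transferVar j true  = (j , transfer) , true , zero
  transferVar j false = (j , transfer) , false , zero

  copy-injective : ∀ {n n'} → copy n ≡ copy n' → n ≡ n'
  copy-injective {j , s , i} {.j , .s , .i} refl = refl

  copy≢transferVar : ∀ n {j s} → copy n ≢ transferVar j s
  copy≢transferVar (_ , _ , _) {s = true}  ()
  copy≢transferVar (_ , _ , _) {s = false} ()

  copy≢definedVar : ∀ n {j s} → copy n ≢ definedVar j s
  copy≢definedVar (_ , _ , _) ()

  fresh-injective : ∀ {j s j' s'} → fresh j s ≡ fresh j' s' → (j , s) ≡ (j' , s')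
  fresh-injective = interleave-injective fresh (proj₁ isFresh)

  label≢fresh : ∀ n j s → label {cs = χ} n ≢ fresh j s
  label≢fresh n j s eq =
    All.lookup (proj₂ isFresh) (∈-interleave fresh j s) (subst (_∈ allVars χ) eq (label∈allVars χ n))

  labelled-fresh : ∀ {j s} v → nfLabel v ≡ fresh j s → v ≡ definedVar j s ⊎ v ≡ transferVar j s
  labelled-fresh {j} {s} ((j' , define s') , true , zero) eq
    with refl ← fresh-injective {j'} {s'} {j} {s} eq = inj₁ refl
  labelled-fresh {j} {s} ((j' , define s') , false , i) eq = ⊥-elim (label≢fresh (j' , s' , i) j s eq)
  labelled-fresh {j} {s} ((j' , transfer) , true , zero) eq
    with refl ← fresh-injective {j'} {true} {j} {s} eq = inj₂ refl
  labelled-fresh {j} {s} ((j' , transfer) , false , zero) eq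
    with refl ← fresh-injective {j'} {false} {j} {s} eq = inj₂ refl

  labelled-original : ∀ {n} v → nfLabel v ≡ label {cs = χ} n → Σ[ m ∈ Node χ ] v ≡ copy m
  labelled-original {n} ((j , define s) , true , zero) eq  = ⊥-elim (label≢fresh n j s (sym eq))
  labelled-original     ((j , define s) , false , i) eq    = (j , s , i) , refl
  labelled-original {n} ((j , transfer) , true , zero) eq  = ⊥-elim (label≢fresh n j true (sym eq))
  labelled-original {n} ((j , transfer) , false , zero) eq = ⊥-elim (label≢fresh n j false (sym eq))

  copy→transferVar : ∀ j s i → copy (j , s , i) ↦ transferVar j s
  copy→transferVar j true  i = definedVar j true , (λ ()) , (refl , refl) , refl
  copy→transferVar j false i = definedVar j false , (λ ()) , (refl , refl) , refl

  transferVar→definedVar : ∀ j s → transferVar j s ↦ definedVar j (not s)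
  transferVar→definedVar j true  = transferVar j false , (λ ()) , (refl , refl) , refl
  transferVar→definedVar j false = transferVar j true , (λ ()) , (refl , refl) , refl

  definedVar→copy : ∀ {j s i m} → Edge χ (j , s , i) m → definedVar j (not s) ↦ copy m
  definedVar→copy {j} {s} ((.j , .(not s) , i') , n'≢m , (refl , refl) , eq) =
    copy (j , not s , i') , (λ c≡c → n'≢m (copy-injective c≡c)) , (refl , refl) , eq

  copy-successor : ∀ {j s i v} → copy (j , s , i) ↦ v → v ≡ transferVar j s
  copy-successor {v = v} ((_ , _ , zero) , p'≢v , (refl , refl) , eq) with labelled-fresh v (sym eq)
  ... | inj₁ v≡p' = ⊥-elim (p'≢v (sym v≡p'))
  ... | inj₂ v≡t  = v≡t

  transferVar-successor : ∀ {j s v} → transferVar j s ↦ v → v ≡ definedVar j (not s)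
  transferVar-successor {s = true} {v} ((_ , _ , zero) , p'≢v , (refl , refl) , eq)
    with labelled-fresh v (sym eq)
  ... | inj₁ v≡d  = v≡d
  ... | inj₂ v≡p' = ⊥-elim (p'≢v (sym v≡p'))
  transferVar-successor {s = false} {v} ((_ , _ , zero) , p'≢v , (refl , refl) , eq)
    with labelled-fresh v (sym eq)
  ... | inj₁ v≡d  = v≡d
  ... | inj₂ v≡p' = ⊥-elim (p'≢v (sym v≡p'))

  definedVar-successor : ∀ {j s v} → definedVar j (not s) ↦ v →
                         Σ[ m ∈ Node χ ] v ≡ copy m × (∀ i → Edge χ (j , s , i) m)
  definedVar-successor {j} {s} {v} ((_ , _ , i') , p'≢v , (refl , refl) , eq)
    with m , refl ← labelled-original {j , not s , i'} v (sym eq) =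
    m , refl , λ i → (j , not s , i') , (λ n≡m → p'≢v (cong copy n≡m)) , (refl , refl) , eq

  expand : ∀ {n m} → Edge χ n m → copy n ⇝ copy m
  expand {j , s , i} e =
    copy→transferVar j s i ∷ transferVar→definedVar j s ∷ [ definedVar→copy {j} {s} {i} e ]

  contract : ∀ {n m} → copy n ⇝ copy m → n ⇝χ m
  contract-transferVar : ∀ {j s i m} → transferVar j s ⇝ copy m → (j , s , i) ⇝χ m
  contract-definedVar : ∀ {j s i m} → definedVar j (not s) ⇝ copy m → (j , s , i) ⇝χ m

  contract {j , s , i} {m} [ e ] = ⊥-elim (copy≢transferVar m (copy-successor {j} {s} {i} e))
  contract {j , s , i} (e ∷ es) with refl ← copy-successor {j} {s} {i} e = contract-transferVar es

  contract-transferVar {j} {s} {m = m} [ e ] =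
    ⊥-elim (copy≢definedVar m (transferVar-successor {j} {s} e))
  contract-transferVar {j} {s} (e ∷ es) with refl ← transferVar-successor {j} {s} e =
    contract-definedVar es

  contract-definedVar {j} {s} {i} [ e ] with m , copy≡copy , edge ← definedVar-successor {j} {s} e =
    [ subst (Edge χ (j , s , i)) (sym (copy-injective copy≡copy)) (edge i) ]
  contract-definedVar {j} {s} {i} (e ∷ es) with m , refl , edge ← definedVar-successor {j} {s} e =
    edge i ∷ contract es

  definedVar-cycle : ∀ j s → definedVar j (not s) ⇝ definedVar j (not s) →
                     Σ[ n ∈ Node χ ] copy n ⇝ copy n
  definedVar-cycle j s cyc with _ , e , cyc' ← rotate cyc
                           with m , refl , _ ← definedVar-successor {j} {s} e = m , cyc'

  cycle-through-copy : Cycle (uncurry nfBlock) → Σ[ n ∈ Node χ ] copy n ⇝ copy n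
  cycle-through-copy (((j , define s) , false , i) , cyc)     = (j , s , i) , cyc
  cycle-through-copy (((j , define true) , true , zero) , cyc)  = definedVar-cycle j false cyc
  cycle-through-copy (((j , define false) , true , zero) , cyc) = definedVar-cycle j true cyc
  cycle-through-copy (((j , transfer) , true , zero) , cyc)
    with _ , e , cyc' ← rotate cyc
    with refl ← transferVar-successor {j} {true} e = definedVar-cycle j true cyc'
  cycle-through-copy (((j , transfer) , false , zero) , cyc)
    with _ , e , cyc' ← rotate cyc
    with refl ← transferVar-successor {j} {false} e = definedVar-cycle j false cyc'

  chain⇒normal-cycle : Chain χ → Cycle (uncurry nfBlock)
  chain⇒normal-cycle (n , cyc) = copy n , bind⁺ copy expand cyc

  normal-cycle⇒chain : Cycle (uncurry nfBlock) → Chain χ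
  normal-cycle⇒chain cyc with n , cyc' ← cycle-through-copy cyc = n , contract cyc'

lemma10 : (k : ℕ) (χ : List (Constraint k)) → AllRational χ →
          (f : Fin (length χ) → Var × Var) → Fresh χ f →
          (ChainFree χ → ChainFree (normalForm χ f)) × (ChainFree (normalForm χ f) → ChainFree χ)
lemma10 k χ _ f isFresh =
    (λ χ-free nf-chain → χ-free (normal-cycle⇒chain (Embedding.map-cycle (decoding nfBlock) nf-chain)))
  , (λ nf-free chain → nf-free (Embedding.map-cycle (encoding nfBlock) (chain⇒normal-cycle chain)))
  where open NormalForm χ f isFresh
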